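{- Let $k_E$ be a field, let $t_1,\dots,t_d$ be distinct nonnegative integers and $\delta_1,\dots,\delta_d$ nonnegative integers, and put $\delta=\max_i\delta_i$; assume $|t_{i_1}-t_{i_2}|>\delta$ for all $i_1\ne i_2$. Let $X\in\mathrm{Mat}_d(k_E[u])$ be upper triangular with $\mathrm{diag}\,X=[u^{t_1+\delta_1},\dots,u^{t_d+\delta_d}]$, and let $A\in\mathrm{GL}_d(k_E)$. Suppose that $X$ satisfies (DEG) and that $u^{t_i}$ divides every entry of the $i$-th column of $XA$ for every $i$. Then $X=X_1X_0$, where - $X_0$ is upper triangular with $\mathrm{diag}\,X_0=[u^{t_1},\dots,u^{t_d}]$ and satisfies property (P); - $X_1$ is upper triangular with $\mathrm{diag}\,X_1=[u^{\delta_1},\dots,u^{\delta_d}]$ and satisfies (DEG); - $X_0A=B\,[u^{t_1},\dots,u^{t_d}]$ for some $B\in\mathrm{GL}_d(k_E+u^\delta k_E[[u]])$.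
   Context: $[a_1,\dots,a_d]$ denotes a diagonal matrix and $\mathrm{diag}\,X$ the diagonal matrix formed by the diagonal of $X$. Let $X=(x_{i,j})\in\mathrm{Mat}_d(k_E[u])$ be upper triangular with diagonal entries $x_{i,i}=u^{s_i}$ for nonnegative integers $s_i$. $X$ satisfies (DEG) if $\deg(x_{i,j})<s_j$ for all $i<j$. $X$ satisfies property (P) if for all $i<j$, $x_{i,j}=u^{s_i}y_{i,j}$ where $y_{i,j}=0$ if $s_i>s_j$ and $y_{i,j}\in k_E$ if $s_i<s_j$. $\mathrm{GL}_d(k_E+u^\delta k_E[[u]])$ denotes invertible matrices with entries (and inverse entries) in the subring $k_E+u^\delta k_E[[u]]$ of $k_E[[u]]$. -}

module Defs where

open import Level using (Level)
open import Data.Nat as ℕ using (ℕ; zero; suc; _≤_; _<_; _∸_)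
open import Data.Fin as Fin using (Fin; toℕ)
open import Data.Product using (Σ; ∃; _×_; _,_)
open import Relation.Nullary using (¬_; yes; no)
open import Relation.Binary.PropositionalEquality using (_≡_)
open import Algebra.Bundles using (CommutativeRing)

record Field (c ℓ : Level) : Set (Level.suc (c Level.⊔ ℓ)) where
  field
    commutativeRing : CommutativeRing c ℓ
  open CommutativeRing commutativeRing public
  field
    0≉1     : ¬ (0# ≈ 1#)
    inverse : ∀ x → ¬ (x ≈ 0#) → Σ Carrier (λ y → x * y ≈ 1#)

maxFin : (d : ℕ) → (Fin d → ℕ) → ℕ
maxFin zero    f = 0
maxFin (suc d) f = f Fin.zero ℕ.⊔ maxFin d (λ i → f (Fin.suc i))

module FieldDefs {c ℓ : Level} (F : Field c ℓ) where
  open Field F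

  sumFin : (n : ℕ) → (Fin n → Carrier) → Carrier
  sumFin zero    f = 0#
  sumFin (suc n) f = f Fin.zero + sumFin n (λ i → f (Fin.suc i))

  Series : Set c
  Series = ℕ → Carrier

  _≋_ : Series → Series → Set ℓ
  f ≋ g = ∀ n → f n ≈ g n

  0s : Series
  0s _ = 0#

  const : Carrier → Series
  const a zero    = a
  const a (suc _) = 0#

  uPow : ℕ → Series
  uPow zero    zero    = 1#
  uPow zero    (suc _) = 0#
  uPow (suc m) zero    = 0#
  uPow (suc m) (suc n) = uPow m n

  _+s_ : Series → Series → Series
  (f +s g) n = f n + g n

  _*s_ : Series → Series → Series
  (f *s g) n = sumFin (suc n) (λ i → f (toℕ i) * g (n ∸ toℕ i))

  IsPoly : Series → Set ℓ
  IsPoly f = Σ ℕ (λ N → ∀ n → N ≤ n → f n ≈ 0#)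

  -- deg f < s  (the zero polynomial has degree -∞)
  DegLt : Series → ℕ → Set ℓ
  DegLt f s = ∀ n → s ≤ n → f n ≈ 0#

  UPowDivides : ℕ → Series → Set (c Level.⊔ ℓ)
  UPowDivides t f = Σ Series (λ g → IsPoly g × (f ≋ (uPow t *s g)))

  -- f lies in the subring k_E + u^δ k_E[[u]]
  InRδ : ℕ → Series → Set ℓ
  InRδ δ f = ∀ n → 1 ≤ n → n < δ → f n ≈ 0#

  Mat : ℕ → Set c
  Mat d = Fin d → Fin d → Series

  MatK : ℕ → Set c
  MatK d = Fin d → Fin d → Carrier

  _≋M_ : {d : ℕ} → Mat d → Mat d → Set ℓ
  X ≋M Y = ∀ i j → X i j ≋ Y i j

  _*M_ : {d : ℕ} → Mat d → Mat d → Mat d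
  _*M_ {d} X Y i j = foldS d (λ k → X i k *s Y k j)
    where
    foldS : (n : ℕ) → (Fin n → Series) → Series
    foldS zero    f = 0s
    foldS (suc n) f = f Fin.zero +s foldS n (λ k → f (Fin.suc k))

  _*K_ : {d : ℕ} → MatK d → MatK d → MatK d
  _*K_ {d} A B i j = sumFin d (λ k → A i k * B k j)

  idK : {d : ℕ} → MatK d
  idK i j with i Fin.≟ j
  ... | yes _ = 1#
  ... | no  _ = 0#

  idM : {d : ℕ} → Mat d
  idM i j = const (idK i j)

  constM : {d : ℕ} → MatK d → Mat d
  constM A i j = const (A i j)

  diagPow : {d : ℕ} → (Fin d → ℕ) → Mat d
  diagPow s i j with i Fin.≟ j
  ... | yes _ = uPow (s i)
  ... | no  _ = 0s

  PolyMat : {d : ℕ} → Mat d → Set ℓ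
  PolyMat X = ∀ i j → IsPoly (X i j)

  UpperTriangular : {d : ℕ} → Mat d → Set ℓ
  UpperTriangular X = ∀ i j → j Fin.< i → X i j ≋ 0s

  DiagIs : {d : ℕ} → Mat d → (Fin d → ℕ) → Set ℓ
  DiagIs X s = ∀ i → X i i ≋ uPow (s i)

  DEG : {d : ℕ} → Mat d → (Fin d → ℕ) → Set ℓ
  DEG X s = ∀ i j → i Fin.< j → DegLt (X i j) (s j)

  PropP : {d : ℕ} → Mat d → (Fin d → ℕ) → Set (c Level.⊔ ℓ)
  PropP X s = ∀ i j → i Fin.< j →
    Σ Series (λ y → (X i j ≋ (uPow (s i) *s y))
                  × (s j < s i → y ≋ 0s)
                  × (s i < s j → Σ Carrier (λ a → y ≋ const a)))

  GLK : {d : ℕ} → MatK d → Set (c Level.⊔ ℓ)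
  GLK {d} A = Σ (MatK d) (λ A' → (∀ i j → (A *K A') i j ≈ idK i j)
                               × (∀ i j → (A' *K A) i j ≈ idK i j))

  GLδ : {d : ℕ} → ℕ → Mat d → Set (c Level.⊔ ℓ)
  GLδ {d} δ B = (∀ i j → InRδ δ (B i j))
              × Σ (Mat d) (λ B' → (∀ i j → InRδ δ (B' i j))
                                × ((B *M B') ≋M idM)
                                × ((B' *M B) ≋M idM))

{-# OPTIONS --safe #-}
module Submission where

-- Let s i = t i + δs i and let lead be the matrix whose row k holds the coefficients of u^(s k)
-- in row k of X; it is unitriangular. By the divisibility hypothesis G = lead A vanishes at (k, j)
-- whenever t k < t j, and hence so does its inverse H. Therefore the vector of coefficients of u^n
-- in a row of X is determined by its entries in the columns l with t l ≤ n together with the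
-- vanishing of its product with A in the columns j with t j > n. Thanks to the separation of the
-- t i, the same holds for X₁ X₀, where X₀ = diag(u^t) lead and X₁ i j = u^(-t j) X i j with the
-- terms of degree below t j dropped; so X = X₁ X₀. Finally X₀ A = B diag(u^t) with
-- B = diag(u^t) G diag(u^t)⁻¹, whose inverse is diag(u^t) H diag(u^t)⁻¹ and whose entries are
-- constants or multiples of u^(δ+1).

open import Defs
open import Level using (Level)
open import Data.Nat as ℕ using (ℕ; zero; suc)
import Data.Nat.Properties as ℕ
open import Data.Fin as Fin using (Fin; toℕ)
import Data.Fin.Properties as Fin
import Data.Fin.Induction as Fin
import Data.Nat.Induction as ℕ
open import Data.Product using (Σ; _×_; _,_; proj₁; proj₂)
open import Data.Sum using (_⊎_; inj₁; inj₂)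
open import Data.Empty using (⊥-elim)
open import Relation.Nullary using (¬_; yes; no)
open import Relation.Binary.PropositionalEquality as ≡ using (_≡_; _≢_)
open import Relation.Binary.Definitions using (tri<; tri≈; tri>)
open import Induction.WellFounded using (module All)
import Relation.Binary.Construct.On as On
open import Function using (_∘′_)

maxFin-upper : ∀ d (g : Fin d → ℕ) i → g i ℕ.≤ maxFin d g
maxFin-upper (suc d) g Fin.zero    = ℕ.m≤m⊔n _ _
maxFin-upper (suc d) g (Fin.suc i) = ℕ.≤-trans (maxFin-upper d (g ∘′ Fin.suc) i) (ℕ.m≤n⊔m (g Fin.zero) _)

module LinearAlgebra {c ℓ : Level} (F : Field c ℓ) where
  open Field F
  open FieldDefs F
  open import Algebra.Properties.Semiring.Sum semiring public
    using (sum; sum-syntax; sum-cong-≋; sum-replicate-zero; ∑-distrib-+; ∑-comm; *-distribˡ-sum; *-distribʳ-sum)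
  open import Algebra.Properties.Group +-group using (∙-cancelˡ; ∙-cancelʳ; x≈y⇒x∙y⁻¹≈ε; //-rightDividesˡ)
  open import Algebra.Properties.CommutativeSemigroup *-commutativeSemigroup using (x∙yz≈xz∙y)
  open import Relation.Binary.Reasoning.Setoid setoid

  sumFin≡sum : ∀ n (g : Fin n → Carrier) → sumFin n g ≡ sum g
  sumFin≡sum zero    g = ≡.refl
  sumFin≡sum (suc n) g = ≡.cong (g Fin.zero +_) (sumFin≡sum n (λ i → g (Fin.suc i)))

  ∑-zero : ∀ {n} (g : Fin n → Carrier) → (∀ i → g i ≈ 0#) → sum g ≈ 0#
  ∑-zero {n} g g≈0 = trans (sum-cong-≋ g≈0) (sum-replicate-zero n)

  ∑-single : ∀ {n} (g : Fin n → Carrier) k → (∀ i → i ≢ k → g i ≈ 0#) → sum g ≈ g k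
  ∑-single g Fin.zero    off = trans (+-congˡ (∑-zero _ (λ i → off (Fin.suc i) λ ()))) (+-identityʳ _)
  ∑-single g (Fin.suc k) off = trans (+-congʳ (off Fin.zero λ ()))
    (trans (+-identityˡ _) (∑-single _ k (λ i i≢k → off (Fin.suc i) (λ e → i≢k (Fin.suc-injective e)))))

  ∑-cancel : ∀ {n} (g h : Fin n → Carrier) k → (∀ i → i ≢ k → g i ≈ h i) → sum g ≈ sum h → g k ≈ h k
  ∑-cancel g h Fin.zero off eq =
    ∙-cancelʳ _ _ _ (trans eq (+-congˡ (sym (sum-cong-≋ (λ i → off (Fin.suc i) λ ())))))
  ∑-cancel g h (Fin.suc k) off eq =
    ∑-cancel _ _ k (λ i i≢k → off (Fin.suc i) (λ e → i≢k (Fin.suc-injective e)))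
      (∙-cancelˡ _ _ _ (trans (+-congʳ (sym (off Fin.zero λ ()))) eq))

  Row : ℕ → Set c
  Row d = Fin d → Carrier

  _≈ᵣ_ : ∀ {d} → Row d → Row d → Set ℓ
  v ≈ᵣ w = ∀ j → v j ≈ w j

  _≈ₘ_ : ∀ {d} → MatK d → MatK d → Set ℓ
  M ≈ₘ N = ∀ i → M i ≈ᵣ N i

  infixl 7 _·_ _⊗_

  _·_ : ∀ {d} → Row d → MatK d → Row d
  _·_ {d} v M j = ∑[ k < d ] (v k * M k j)

  _⊗_ : ∀ {d} → MatK d → MatK d → MatK d
  (M ⊗ N) i = M i · N

  Inverse : ∀ {d} → MatK d → MatK d → Set ℓ
  Inverse M N = (M ⊗ N) ≈ₘ idK × (N ⊗ M) ≈ₘ idK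

  *K≈⊗ : ∀ {d} (M N : MatK d) i j → (M *K N) i j ≈ (M ⊗ N) i j
  *K≈⊗ {d} M N i j = reflexive (sumFin≡sum d (λ k → M i k * N k j))

  idK-diag : ∀ {d} (i : Fin d) → idK i i ≈ 1#
  idK-diag i with i Fin.≟ i
  ... | yes _   = refl
  ... | no i≢i = ⊥-elim (i≢i ≡.refl)

  idK-off : ∀ {d} {i j : Fin d} → i ≢ j → idK i j ≈ 0#
  idK-off {i = i} {j} i≢j with i Fin.≟ j
  ... | yes i≡j = ⊥-elim (i≢j i≡j)
  ... | no _    = refl

  ·-congˡ : ∀ {d} {v w : Row d} (M : MatK d) → v ≈ᵣ w → (v · M) ≈ᵣ (w · M)
  ·-congˡ M v≈w j = sum-cong-≋ (λ k → *-congʳ (v≈w k))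

  ·-congʳ : ∀ {d} (v : Row d) {M N : MatK d} → M ≈ₘ N → (v · M) ≈ᵣ (v · N)
  ·-congʳ v M≈N j = sum-cong-≋ (λ k → *-congˡ (M≈N k j))

  ·-identityʳ : ∀ {d} (v : Row d) → (v · idK) ≈ᵣ v
  ·-identityʳ v j = trans (∑-single _ j (λ k k≢j → trans (*-congˡ (idK-off k≢j)) (zeroʳ _)))
                          (trans (*-congˡ (idK-diag j)) (*-identityʳ _))

  idK-· : ∀ {d} (M : MatK d) a → (idK a · M) ≈ᵣ M a
  idK-· M a j = trans (∑-single _ a (λ k k≢a → trans (*-congʳ (idK-off (k≢a ∘′ ≡.sym))) (zeroˡ _)))
                      (trans (*-congʳ (idK-diag a)) (*-identityˡ _))

  ·-assoc : ∀ {d} (v : Row d) (M N : MatK d) → ((v · M) · N) ≈ᵣ (v · (M ⊗ N))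
  ·-assoc {d} v M N j = begin
    ∑[ k < d ] ((∑[ i < d ] (v i * M i k)) * N k j)   ≈⟨ sum-cong-≋ {d} (λ k → *-distribʳ-sum (N k j) (λ i → v i * M i k)) ⟩
    ∑[ k < d ] (∑[ i < d ] (v i * M i k * N k j))     ≈⟨ ∑-comm (λ k i → v i * M i k * N k j) ⟩
    ∑[ i < d ] (∑[ k < d ] (v i * M i k * N k j))     ≈⟨ sum-cong-≋ {d} (λ i → sum-cong-≋ {d} (λ k → *-assoc (v i) (M i k) (N k j))) ⟩
    ∑[ i < d ] (∑[ k < d ] (v i * (M i k * N k j)))   ≈⟨ sum-cong-≋ {d} (λ i → sym (*-distribˡ-sum (v i) (λ k → M i k * N k j))) ⟩
    ∑[ i < d ] (v i * (M i · N) j)                    ∎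

  inverse-⊗ : ∀ {d} {M M' N N' : MatK d} → Inverse M M' → Inverse N N' → Inverse (M ⊗ N) (N' ⊗ M')
  inverse-⊗ {M = M} {M'} {N} {N'} (MM' , M'M) (NN' , N'N) = cancel M N N' M' NN' MM' , cancel N' M' M N M'M N'N
    where
    cancel : ∀ P Q Q' P' → (Q ⊗ Q') ≈ₘ idK → (P ⊗ P') ≈ₘ idK → ((P ⊗ Q) ⊗ (Q' ⊗ P')) ≈ₘ idK
    cancel P Q Q' P' QQ' PP' i j = begin
      ((P i · Q) · (Q' ⊗ P')) j   ≈⟨ sym (·-assoc _ Q' P' j) ⟩
      (((P i · Q) · Q') · P') j   ≈⟨ ·-congˡ P' (·-assoc (P i) Q Q') j ⟩
      ((P i · (Q ⊗ Q')) · P') j   ≈⟨ ·-congˡ P' (·-congʳ (P i) QQ') j ⟩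
      ((P i · idK) · P') j        ≈⟨ ·-congˡ P' (·-identityʳ (P i)) j ⟩
      (P i · P') j                ≈⟨ PP' i j ⟩
      idK i j                     ∎

  module Unitriangular {d} (U : MatK d) (U-diag : ∀ k → U k k ≈ 1#)
                       (U-lower : ∀ k l → l Fin.< k → U k l ≈ 0#) where

    ·-cancel : (c c' : Row d) → (∀ l → (c · U) l ≈ (c' · U) l ⊎ c l ≈ c' l) → c ≈ᵣ c'
    ·-cancel c c' hyp = All.wfRec Fin.<-wellFounded ℓ (λ l → c l ≈ c' l) step
      where
      step : ∀ l → (∀ {k} → k Fin.< l → c k ≈ c' k) → c l ≈ c' l
      step l _  with hyp l
      step l _  | inj₂ cₗ≈c'ₗ = cₗ≈c'ₗ
      step l ih | inj₁ cU≈c'U = begin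
        c l             ≈⟨ sym (*-identityʳ _) ⟩
        c l * 1#        ≈⟨ *-congˡ (sym (U-diag l)) ⟩
        c l * U l l     ≈⟨ ∑-cancel _ _ l agree cU≈c'U ⟩
        c' l * U l l    ≈⟨ *-congˡ (U-diag l) ⟩
        c' l * 1#       ≈⟨ *-identityʳ _ ⟩
        c' l            ∎
        where
        agree : ∀ k → k ≢ l → c k * U k l ≈ c' k * U k l
        agree k k≢l with Fin.<-cmp k l
        ... | tri< k<l _ _ = *-congʳ (ih k<l)
        ... | tri≈ _ k≡l _ = ⊥-elim (k≢l k≡l)
        ... | tri> _ _ l<k = trans (*-congˡ (U-lower k l l<k))
                               (trans (zeroʳ _) (sym (trans (*-congˡ (U-lower k l l<k)) (zeroʳ _))))

    -- Gaussian elimination; eliminate k m handles vectors whose first m entries are already cleared.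
    ·-surjective : (v : Row d) → Σ (Row d) (λ c → v ≈ᵣ (c · U))
    ·-surjective v = eliminate d 0 ≡.refl v (λ l ())
      where
      eliminate : ∀ k m → m ℕ.+ k ≡ d → (v : Row d) → (∀ l → toℕ l ℕ.< m → v l ≈ 0#) →
                  Σ (Row d) (λ c → v ≈ᵣ (c · U))
      eliminate zero m m+0≡d v v≈0 = (λ _ → 0#) , λ l →
        trans (v≈0 l (≡.subst (toℕ l ℕ.<_) (≡.trans (≡.sym m+0≡d) (ℕ.+-identityʳ m)) (Fin.toℕ<n l)))
              (sym (∑-zero (λ k → 0# * U k l) (λ k → zeroˡ _)))
      eliminate (suc k) m m+1+k≡d v v≈0 = solution , v≈solution·U
        where
        m<d : m ℕ.< d
        m<d = ≡.subst (m ℕ.<_) m+1+k≡d (ℕ.m<m+n m ℕ.z<s)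
        p : Fin d
        p = Fin.fromℕ< m<d
        w : Row d
        w l = v l - v p * U p l
        w≈0 : ∀ l → toℕ l ℕ.< suc m → w l ≈ 0#
        w≈0 l l≤m = x≈y⇒x∙y⁻¹≈ε (vₗ≈ l l≤m)
          where
          vₗ≈ : ∀ l → toℕ l ℕ.< suc m → v l ≈ v p * U p l
          vₗ≈ l l≤m with ℕ.m≤n⇒m<n∨m≡n (ℕ.s≤s⁻¹ l≤m)
          ... | inj₁ l<m = trans (v≈0 l l<m) (sym (trans (*-congˡ (U-lower p l
                             (≡.subst (toℕ l ℕ.<_) (≡.sym (Fin.toℕ-fromℕ< m<d)) l<m))) (zeroʳ _)))
          ... | inj₂ l≡m with Fin.toℕ-injective (≡.trans l≡m (≡.sym (Fin.toℕ-fromℕ< m<d)))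
          ...   | ≡.refl = sym (trans (*-congˡ (U-diag p)) (*-identityʳ _))
        recursive : Σ (Row d) (λ c → w ≈ᵣ (c · U))
        recursive = eliminate k (suc m) (≡.trans (≡.sym (ℕ.+-suc m k)) m+1+k≡d) w w≈0
        solution : Row d
        solution l = proj₁ recursive l + v p * idK p l
        v≈solution·U : v ≈ᵣ (solution · U)
        v≈solution·U l = begin
          v l                                                 ≈⟨ sym (//-rightDividesˡ (v p * U p l) (v l)) ⟩
          w l + v p * U p l                                   ≈⟨ +-cong (proj₂ recursive l) (*-congˡ (sym (idK-· U p l))) ⟩
          (proj₁ recursive · U) l + v p * (idK p · U) l       ≈⟨ +-congˡ (*-distribˡ-sum (v p) (λ j → idK p j * U j l)) ⟩
          (proj₁ recursive · U) l + ∑[ j < d ] (v p * (idK p j * U j l))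
                                                              ≈⟨ sym (∑-distrib-+ (λ j → proj₁ recursive j * U j l) (λ j → v p * (idK p j * U j l))) ⟩
          ∑[ j < d ] (proj₁ recursive j * U j l + v p * (idK p j * U j l))
                                                              ≈⟨ sum-cong-≋ {d} (λ j → +-congˡ (sym (*-assoc _ _ _))) ⟩
          ∑[ j < d ] (proj₁ recursive j * U j l + v p * idK p j * U j l)
                                                              ≈⟨ sum-cong-≋ {d} (λ j → sym (distribʳ _ _ _)) ⟩
          (solution · U) l                                    ∎

    invertible : Σ (MatK d) (λ L → Inverse L U)
    invertible = L , (λ a j → sym (proj₂ (·-surjective (idK a)) j)) , UL
      where
      L : MatK d
      L a = proj₁ (·-surjective (idK a))
      UL : (U ⊗ L) ≈ₘ idK
      UL a = ·-cancel (U a · L) (idK a) λ l → inj₁ (begin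
        ((U a · L) · U) l   ≈⟨ ·-assoc (U a) L U l ⟩
        (U a · (L ⊗ U)) l   ≈⟨ ·-congʳ (U a) (λ b j → sym (proj₂ (·-surjective (idK b)) j)) l ⟩
        (U a · idK) l       ≈⟨ ·-identityʳ (U a) l ⟩
        U a l               ≈⟨ sym (idK-· U a l) ⟩
        (idK a · U) l       ∎)

  module PowerTriangular {d} (t : Fin d → ℕ) where

    TLower : MatK d → Set ℓ
    TLower M = ∀ i j → t i ℕ.< t j → M i j ≈ 0#

    inverse-tlower : (∀ i j → i ≢ j → t i ≢ t j) → {G H : MatK d} →
                     TLower G → (H ⊗ G) ≈ₘ idK → TLower H
    inverse-tlower t-injective {G} {H} G-tlower HG≈1 a p =
      -- downward induction on t p
      All.wfRec (On.wellFounded (λ q → top ℕ.∸ t q) ℕ.<-wellFounded) ℓ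
        (λ q → ∀ a → t a ℕ.< t q → H a q ≈ 0#) step p a
      where
      top : ℕ
      top = suc (maxFin d t)
      step : ∀ p → (∀ {q} → top ℕ.∸ t q ℕ.< top ℕ.∸ t p → ∀ a → t a ℕ.< t q → H a q ≈ 0#) →
             ∀ a → t a ℕ.< t p → H a p ≈ 0#
      step p ih a ta<tp = begin
        H a p                     ≈⟨ sym (*-identityʳ _) ⟩
        H a p * 1#                ≈⟨ *-congˡ (sym (trans (sym (pivot p ℕ.≤-refl)) (trans (HG≈1 p p) (idK-diag p)))) ⟩
        H a p * (H p p * G p p)   ≈⟨ x∙yz≈xz∙y _ _ _ ⟩
        H a p * G p p * H p p     ≈⟨ *-congʳ (trans (sym (pivot a (ℕ.<⇒≤ ta<tp))) (trans (HG≈1 a p) (idK-off a≢p))) ⟩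
        0# * H p p                ≈⟨ zeroˡ _ ⟩
        0#                        ∎
        where
        a≢p : a ≢ p
        a≢p ≡.refl = ℕ.<-irrefl ≡.refl ta<tp
        pivot : ∀ b → t b ℕ.≤ t p → (H b · G) p ≈ H b p * G p p
        pivot b tb≤tp = ∑-single _ p vanish
          where
          vanish : ∀ k → k ≢ p → H b k * G k p ≈ 0#
          vanish k k≢p with ℕ.<-cmp (t k) (t p)
          ... | tri< tk<tp _ _ = trans (*-congˡ (G-tlower k p tk<tp)) (zeroʳ _)
          ... | tri≈ _ tk≡tp _ = ⊥-elim (t-injective k p k≢p tk≡tp)
          ... | tri> _ _ tp<tk = trans (*-congʳ (ih (ℕ.∸-monoʳ-< tp<tk (ℕ.<⇒≤ (ℕ.s≤s (maxFin-upper d t k))))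
                                                    b (ℕ.≤-<-trans tb≤tp tp<tk))) (zeroˡ _)

module Series {c ℓ : Level} (F : Field c ℓ) where
  open Field F
  open FieldDefs F
  open LinearAlgebra F
  open import Relation.Binary.Reasoning.Setoid setoid

  mono : ℕ → Carrier → Series
  mono e a n with n ℕ.≟ e
  ... | yes _ = a
  ... | no  _ = 0#

  mono-at : ∀ e n {a} → n ≡ e → mono e a n ≈ a
  mono-at e n n≡e with n ℕ.≟ e
  ... | yes _   = refl
  ... | no n≢e = ⊥-elim (n≢e n≡e)

  mono-off : ∀ e n {a} → n ≢ e → mono e a n ≈ 0#
  mono-off e n n≢e with n ℕ.≟ e
  ... | yes n≡e = ⊥-elim (n≢e n≡e)
  ... | no _    = refl

  mono-cong : ∀ e {a b} n → a ≈ b → mono e a n ≈ mono e b n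
  mono-cong e n a≈b with n ℕ.≟ e
  ... | yes _ = a≈b
  ... | no _  = refl

  mono-≈0 : ∀ e {a} n → a ≈ 0# → mono e a n ≈ 0#
  mono-≈0 e n a≈0 with n ℕ.≟ e
  ... | yes _ = a≈0
  ... | no _  = refl

  mono-exponent : ∀ {e e'} n {a} → e ≡ e' ⊎ a ≈ 0# → mono e a n ≈ mono e' a n
  mono-exponent n (inj₁ ≡.refl) = refl
  mono-exponent {e} {e'} n (inj₂ a≈0) = trans (mono-≈0 e n a≈0) (sym (mono-≈0 e' n a≈0))

  mono-*ʳ : ∀ e n a b → mono e a n * b ≈ mono e (a * b) n
  mono-*ʳ e n a b with n ℕ.≟ e
  ... | yes _ = refl
  ... | no _  = zeroˡ b

  ∑-mono : ∀ d e n (a : Fin d → Carrier) → ∑[ k < d ] mono e (a k) n ≈ mono e (sum a) n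
  ∑-mono d e n a with n ℕ.≟ e
  ... | yes _ = refl
  ... | no _  = ∑-zero {d} (λ _ → 0#) (λ _ → refl)

  uPow-off : ∀ {m n} → n ≢ m → uPow m n ≈ 0#
  uPow-off {zero}  {zero}  n≢m = ⊥-elim (n≢m ≡.refl)
  uPow-off {zero}  {suc n} n≢m = refl
  uPow-off {suc m} {zero}  n≢m = refl
  uPow-off {suc m} {suc n} n≢m = uPow-off (n≢m ∘′ ≡.cong suc)

  uPow-at : ∀ m → uPow m m ≈ 1#
  uPow-at zero    = refl
  uPow-at (suc m) = uPow-at m

  uPow-+ : ∀ a b n → uPow (a ℕ.+ b) (a ℕ.+ n) ≡ uPow b n
  uPow-+ zero    b n = ≡.refl
  uPow-+ (suc a) b n = uPow-+ a b n

  uPow≋mono : ∀ m → uPow m ≋ mono m 1#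
  uPow≋mono m n with n ℕ.≟ m
  ... | yes ≡.refl = uPow-at m
  ... | no n≢m     = uPow-off n≢m

  const≋mono : ∀ a → const a ≋ mono 0 a
  const≋mono a zero    = refl
  const≋mono a (suc n) = refl

  *s-as-sum : ∀ f g n → (f *s g) n ≈ ∑[ i < suc n ] (f (toℕ i) * g (n ℕ.∸ toℕ i))
  *s-as-sum f g n = reflexive (sumFin≡sum (suc n) (λ i → f (toℕ i) * g (n ℕ.∸ toℕ i)))

  *s-cong : ∀ {f f' g g'} → f ≋ f' → g ≋ g' → (f *s g) ≋ (f' *s g')
  *s-cong {f} {f'} {g} {g'} f≋f' g≋g' n =
    trans (*s-as-sum f g n) (trans (sum-cong-≋ {suc n} (λ i → *-cong (f≋f' (toℕ i)) (g≋g' (n ℕ.∸ toℕ i)))) (sym (*s-as-sum f' g' n)))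

  *s-zeroʳ : ∀ f n → (f *s 0s) n ≈ 0#
  *s-zeroʳ f n = trans (*s-as-sum f 0s n) (∑-zero {suc n} (λ i → f (toℕ i) * 0#) (λ i → zeroʳ _))

  *s-mono-≥ : ∀ f e a n → e ℕ.≤ n → (f *s mono e a) n ≈ f (n ℕ.∸ e) * a
  *s-mono-≥ f e a n e≤n = begin
    (f *s mono e a) n                                      ≈⟨ *s-as-sum f (mono e a) n ⟩
    ∑[ i < suc n ] (f (toℕ i) * mono e a (n ℕ.∸ toℕ i))   ≈⟨ ∑-single _ k off ⟩
    f (toℕ k) * mono e a (n ℕ.∸ toℕ k)                     ≈⟨ *-cong (reflexive (≡.cong f toℕk≡n∸e))
                                                                (mono-at e (n ℕ.∸ toℕ k) (≡.trans (≡.cong (n ℕ.∸_) toℕk≡n∸e) (ℕ.m∸[m∸n]≡n e≤n))) ⟩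
    f (n ℕ.∸ e) * a                                        ∎
    where
    n∸e<1+n : n ℕ.∸ e ℕ.< suc n
    n∸e<1+n = ℕ.s≤s (ℕ.m∸n≤m n e)
    k : Fin (suc n)
    k = Fin.fromℕ< n∸e<1+n
    toℕk≡n∸e : toℕ k ≡ n ℕ.∸ e
    toℕk≡n∸e = Fin.toℕ-fromℕ< n∸e<1+n
    off : ∀ i → i ≢ k → f (toℕ i) * mono e a (n ℕ.∸ toℕ i) ≈ 0#
    off i i≢k = trans (*-congˡ (mono-off e (n ℕ.∸ toℕ i) λ n∸i≡e → i≢k (Fin.toℕ-injective
      (≡.trans (≡.sym (ℕ.m∸[m∸n]≡n (ℕ.s≤s⁻¹ (Fin.toℕ<n i))))
               (≡.trans (≡.cong (n ℕ.∸_) n∸i≡e) (≡.sym toℕk≡n∸e)))))) (zeroʳ _)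

  *s-mono-< : ∀ f e a n → n ℕ.< e → (f *s mono e a) n ≈ 0#
  *s-mono-< f e a n n<e = trans (*s-as-sum f (mono e a) n) (∑-zero {suc n} (λ i → f (toℕ i) * mono e a (n ℕ.∸ toℕ i)) (λ i →
    trans (*-congˡ (mono-off e (n ℕ.∸ toℕ i) {a} λ n∸i≡e →
      ℕ.<⇒≱ n<e (≡.subst (ℕ._≤ n) n∸i≡e (ℕ.m∸n≤m n (toℕ i))))) (zeroʳ _)))

  *s-mono-scale : ∀ f e a n → (f *s mono e a) n ≈ (f *s mono e 1#) n * a
  *s-mono-scale f e a n with e ℕ.≤? n
  ... | yes e≤n = trans (*s-mono-≥ f e a n e≤n)
                        (sym (trans (*-congʳ (*s-mono-≥ f e 1# n e≤n)) (*-congʳ (*-identityʳ _))))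
  ... | no e≰n  = trans (*s-mono-< f e a n (ℕ.≰⇒> e≰n))
                        (sym (trans (*-congʳ (*s-mono-< f e 1# n (ℕ.≰⇒> e≰n))) (zeroˡ a)))

  uPow-*s-< : ∀ e g n → n ℕ.< e → (uPow e *s g) n ≈ 0#
  uPow-*s-< e g n n<e = trans (*s-as-sum (uPow e) g n) (∑-zero {suc n} (λ i → uPow e (toℕ i) * g (n ℕ.∸ toℕ i)) (λ i →
    trans (*-congʳ (uPow-off λ i≡e → ℕ.<⇒≱ n<e (≡.subst (ℕ._≤ n) i≡e (ℕ.s≤s⁻¹ (Fin.toℕ<n i)))))
          (zeroˡ _)))

  *s-const : ∀ f a n → (f *s const a) n ≈ f n * a
  *s-const f a n = trans (*s-cong {f} {f} (λ _ → refl) (const≋mono a) n) (*s-mono-≥ f 0 a n ℕ.z≤n)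

  mono-*s-mono : ∀ e e' a b → (mono e a *s mono e' b) ≋ mono (e ℕ.+ e') (a * b)
  mono-*s-mono e e' a b n with e' ℕ.≤? n
  ... | no e'≰n = trans (*s-mono-< (mono e a) e' b n (ℕ.≰⇒> e'≰n))
                        (sym (mono-off (e ℕ.+ e') n λ n≡e+e' → e'≰n (≡.subst (e' ℕ.≤_) (≡.sym n≡e+e') (ℕ.m≤n+m e' e))))
  ... | yes e'≤n with (n ℕ.∸ e') ℕ.≟ e
  ...   | yes n∸e'≡e = trans (*s-mono-≥ (mono e a) e' b n e'≤n) (trans (*-congʳ (mono-at e (n ℕ.∸ e') n∸e'≡e))
                         (sym (mono-at (e ℕ.+ e') n (≡.trans (≡.sym (ℕ.m∸n+n≡m e'≤n)) (≡.cong (ℕ._+ e') n∸e'≡e)))))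
  ...   | no n∸e'≢e  = trans (*s-mono-≥ (mono e a) e' b n e'≤n) (trans (*-congʳ (mono-off e (n ℕ.∸ e') n∸e'≢e))
                         (trans (zeroˡ b) (sym (mono-off (e ℕ.+ e') n λ n≡e+e' →
                           n∸e'≢e (≡.trans (≡.cong (ℕ._∸ e') n≡e+e') (ℕ.m+n∸n≡m e e'))))))

  *M-coeff : ∀ {d} (X Y : Mat d) i j n → (X *M Y) i j n ≈ ∑[ k < d ] ((X i k *s Y k j) n)
  *M-coeff {suc zero}    X Y i j n = refl
  *M-coeff {suc (suc d)} X Y i j n =
    +-congˡ (*M-coeff (λ _ k → X i (Fin.suc k)) (λ k _ → Y (Fin.suc k) j) Fin.zero Fin.zero n)

module PowerMatrices {c ℓ : Level} (F : Field c ℓ) {d : ℕ} (t : Fin d → ℕ) where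
  open Field F
  open FieldDefs F
  open LinearAlgebra F
  open PowerTriangular t
  open Series F
  open import Relation.Binary.Reasoning.Setoid setoid

  -- uRows M = diag(u^t) M, and uConj M = diag(u^t) M diag(u^t)⁻¹ when M is TLower
  -- (otherwise the truncated subtraction t i ∸ t j makes it meaningless).
  uRows : MatK d → Mat d
  uRows M i j = mono (t i) (M i j)

  uConj : MatK d → Mat d
  uConj M i j = mono (t i ℕ.∸ t j) (M i j)

  uRows-*M-constM : ∀ M N → (uRows M *M constM N) ≋M uRows (M ⊗ N)
  uRows-*M-constM M N i j n = begin
    (uRows M *M constM N) i j n                       ≈⟨ *M-coeff (uRows M) (constM N) i j n ⟩
    ∑[ k < d ] ((uRows M i k *s const (N k j)) n)     ≈⟨ sum-cong-≋ {d} (λ k → *s-const (uRows M i k) (N k j) n) ⟩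
    ∑[ k < d ] (mono (t i) (M i k) n * N k j)         ≈⟨ sum-cong-≋ {d} (λ k → mono-*ʳ (t i) n (M i k) (N k j)) ⟩
    ∑[ k < d ] mono (t i) (M i k * N k j) n           ≈⟨ ∑-mono d (t i) n (λ k → M i k * N k j) ⟩
    uRows (M ⊗ N) i j n                               ∎

  uConj-*M-diagPow : ∀ {M} → TLower M → (uConj M *M diagPow t) ≋M uRows M
  uConj-*M-diagPow {M} M-tlower i j n = begin
    (uConj M *M diagPow t) i j n                       ≈⟨ *M-coeff (uConj M) (diagPow t) i j n ⟩
    ∑[ k < d ] ((uConj M i k *s diagPow t k j) n)      ≈⟨ ∑-single _ j off ⟩
    (uConj M i j *s diagPow t j j) n                   ≈⟨ *s-cong {uConj M i j} (λ _ → refl) diag n ⟩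
    (uConj M i j *s mono (t j) 1#) n                   ≈⟨ mono-*s-mono (t i ℕ.∸ t j) (t j) (M i j) 1# n ⟩
    mono (t i ℕ.∸ t j ℕ.+ t j) (M i j * 1#) n          ≈⟨ mono-cong _ n (*-identityʳ _) ⟩
    mono (t i ℕ.∸ t j ℕ.+ t j) (M i j) n               ≈⟨ mono-exponent n exponent ⟩
    uRows M i j n                                      ∎
    where
    off : ∀ k → k ≢ j → (uConj M i k *s diagPow t k j) n ≈ 0#
    off k k≢j with k Fin.≟ j
    ... | yes k≡j = ⊥-elim (k≢j k≡j)
    ... | no _    = *s-zeroʳ (uConj M i k) n
    diag : diagPow t j j ≋ mono (t j) 1#
    diag with j Fin.≟ j
    ... | yes _   = uPow≋mono (t j)
    ... | no j≢j = ⊥-elim (j≢j ≡.refl)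
    exponent : t i ℕ.∸ t j ℕ.+ t j ≡ t i ⊎ M i j ≈ 0#
    exponent with t i ℕ.<? t j
    ... | yes ti<tj = inj₂ (M-tlower i j ti<tj)
    ... | no ti≮tj  = inj₁ (ℕ.m∸n+n≡m (ℕ.≮⇒≥ ti≮tj))

  uConj-*M : ∀ {M N} → TLower M → TLower N → (uConj M *M uConj N) ≋M uConj (M ⊗ N)
  uConj-*M {M} {N} M-tlower N-tlower i j n = begin
    (uConj M *M uConj N) i j n                                  ≈⟨ *M-coeff (uConj M) (uConj N) i j n ⟩
    ∑[ k < d ] ((uConj M i k *s uConj N k j) n)                 ≈⟨ sum-cong-≋ {d} (λ k →
                                                                     mono-*s-mono (t i ℕ.∸ t k) (t k ℕ.∸ t j) (M i k) (N k j) n) ⟩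
    ∑[ k < d ] mono (t i ℕ.∸ t k ℕ.+ (t k ℕ.∸ t j)) (M i k * N k j) n
                                                                ≈⟨ sum-cong-≋ {d} (λ k → mono-exponent n (exponent k)) ⟩
    ∑[ k < d ] mono (t i ℕ.∸ t j) (M i k * N k j) n             ≈⟨ ∑-mono d (t i ℕ.∸ t j) n (λ k → M i k * N k j) ⟩
    uConj (M ⊗ N) i j n                                         ∎
    where
    exponent : ∀ k → t i ℕ.∸ t k ℕ.+ (t k ℕ.∸ t j) ≡ t i ℕ.∸ t j ⊎ M i k * N k j ≈ 0#
    exponent k with t i ℕ.<? t k | t k ℕ.<? t j
    ... | yes ti<tk | _        = inj₂ (trans (*-congʳ (M-tlower i k ti<tk)) (zeroˡ _))
    ... | no _      | yes tk<tj = inj₂ (trans (*-congˡ (N-tlower k j tk<tj)) (zeroʳ _))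
    ... | no ti≮tk  | no tk≮tj  = inj₁ (≡.trans (≡.sym (ℕ.+-∸-assoc (t i ℕ.∸ t k) (ℕ.≮⇒≥ tk≮tj)))
                                                (≡.cong (ℕ._∸ t j) (ℕ.m∸n+n≡m (ℕ.≮⇒≥ ti≮tk))))

  uConj-idK : uConj idK ≋M idM
  uConj-idK i j n = trans (mono-exponent n exponent) (sym (const≋mono (idK i j) n))
    where
    exponent : t i ℕ.∸ t j ≡ 0 ⊎ idK i j ≈ 0#
    exponent with i Fin.≟ j
    ... | yes ≡.refl = inj₁ (ℕ.n∸n≡0 (t i))
    ... | no _       = inj₂ refl

  uConj-inverse : ∀ {M N} → TLower M → TLower N → (M ⊗ N) ≈ₘ idK → (uConj M *M uConj N) ≋M idM
  uConj-inverse M-tlower N-tlower MN≈1 i j n =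
    trans (uConj-*M M-tlower N-tlower i j n) (trans (mono-cong _ n (MN≈1 i j)) (uConj-idK i j n))

module Factorisation {c ℓ : Level} (F : Field c ℓ) (d : ℕ) (t δs : Fin d → ℕ)
  (t-injective : ∀ i₁ i₂ → i₁ ≢ i₂ → t i₁ ≢ t i₂)
  (separated : ∀ i₁ i₂ → i₁ ≢ i₂ → maxFin d δs ℕ.< ℕ.∣ t i₁ - t i₂ ∣)
  (X : FieldDefs.Mat F d) (A : FieldDefs.MatK F d)
  (X-poly : FieldDefs.PolyMat F X) (X-upper : FieldDefs.UpperTriangular F X)
  (X-diag : FieldDefs.DiagIs F X (λ i → t i ℕ.+ δs i))
  (A-invertible : FieldDefs.GLK F A)
  (X-deg : FieldDefs.DEG F X (λ i → t i ℕ.+ δs i))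
  (XA-divisible : ∀ j i → FieldDefs.UPowDivides F (t i) (FieldDefs._*M_ F X (FieldDefs.constM F A) j i))
  where
  open Field F
  open FieldDefs F
  open LinearAlgebra F
  open Series F
  open PowerTriangular t
  open PowerMatrices F t
  open import Relation.Binary.Reasoning.Setoid setoid

  s : Fin d → ℕ
  s i = t i ℕ.+ δs i

  δ : ℕ
  δ = maxFin d δs

  s≤t+δ : ∀ i → s i ℕ.≤ t i ℕ.+ δ
  s≤t+δ i = ℕ.+-monoʳ-≤ (t i) (maxFin-upper d δs i)

  separation : ∀ {i j} → i ≢ j → t i ℕ.≤ t j → t i ℕ.+ δ ℕ.< t j
  separation {i} {j} i≢j ti≤tj = ≡.subst (t i ℕ.+ δ ℕ.<_) (ℕ.m+[n∸m]≡n ti≤tj)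
    (ℕ.+-monoʳ-< (t i) (≡.subst (δ ℕ.<_) (ℕ.m≤n⇒∣m-n∣≡n∸m ti≤tj) (separated i j i≢j)))

  s<t : ∀ {i j} → t i ℕ.< t j → s i ℕ.< t j
  s<t {i} ti<tj = ℕ.≤-<-trans (s≤t+δ i) (separation (λ { ≡.refl → ℕ.<-irrefl ≡.refl ti<tj }) (ℕ.<⇒≤ ti<tj))

  X-vanishes-beyond : ∀ r l n → s l ℕ.< n → X r l n ≈ 0#
  X-vanishes-beyond r l n sl<n with Fin.<-cmp l r
  ... | tri< l<r _ _      = X-upper r l l<r n
  ... | tri≈ _ ≡.refl _   = trans (X-diag r n) (uPow-off {s r} {n} λ { ≡.refl → ℕ.<-irrefl ≡.refl sl<n })
  ... | tri> _ _ r<l      = X-deg r l r<l n (ℕ.<⇒≤ sl<n)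

  row : Fin d → ℕ → Row d
  row r n l = X r l n

  row-·-A : ∀ r n j → n ℕ.< t j → (row r n · A) j ≈ 0#
  row-·-A r n j n<tj with XA-divisible r j
  ... | g , _ , XA≋ = begin
    (row r n · A) j                          ≈⟨ sum-cong-≋ {d} (λ l → sym (*s-const (X r l) (A l j) n)) ⟩
    ∑[ l < d ] ((X r l *s const (A l j)) n)  ≈⟨ sym (*M-coeff X (constM A) r j n) ⟩
    (X *M constM A) r j n                    ≈⟨ XA≋ n ⟩
    (uPow (t j) *s g) n                      ≈⟨ uPow-*s-< (t j) g n n<tj ⟩
    0#                                       ∎

  lead : MatK d
  lead k = row k (s k)

  lead-diag : ∀ k → lead k k ≈ 1#
  lead-diag k = trans (X-diag k (s k)) (uPow-at (s k))

  lead-lower : ∀ k l → l Fin.< k → lead k l ≈ 0#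
  lead-lower k l l<k = X-upper k l l<k (s k)

  lead-tupper : ∀ k l → t l ℕ.< t k → lead k l ≈ 0#
  lead-tupper k l tl<tk = X-vanishes-beyond k l (s k) (ℕ.<-≤-trans (s<t tl<tk) (ℕ.m≤m+n (t k) (δs k)))

  G : MatK d
  G = lead ⊗ A

  G-tlower : TLower G
  G-tlower k j tk<tj = row-·-A k (s k) j (s<t tk<tj)

  A⁻¹ : MatK d
  A⁻¹ = proj₁ A-invertible

  A-inverse : Inverse A A⁻¹
  A-inverse = (λ i j → trans (sym (*K≈⊗ A A⁻¹ i j)) (proj₁ (proj₂ A-invertible) i j))
            , (λ i j → trans (sym (*K≈⊗ A⁻¹ A i j)) (proj₂ (proj₂ A-invertible) i j))

  open Unitriangular lead lead-diag lead-lower using (·-cancel; invertible)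

  L : MatK d
  L = proj₁ invertible

  H : MatK d
  H = A⁻¹ ⊗ L

  G-inverse : Inverse G H
  G-inverse = inverse-⊗ (proj₂ (proj₂ invertible) , proj₁ (proj₂ invertible)) A-inverse

  H-tlower : TLower H
  H-tlower = inverse-tlower t-injective G-tlower (proj₂ G-inverse)

  reconstruct : ∀ v → v ≈ᵣ (((v · A) · H) · lead)
  reconstruct v j = sym (begin
    (((v · A) · H) · lead) j       ≈⟨ ·-assoc (v · A) H lead j ⟩
    ((v · A) · (H ⊗ lead)) j       ≈⟨ ·-congʳ (v · A) H⊗lead≈A⁻¹ j ⟩
    ((v · A) · A⁻¹) j              ≈⟨ ·-assoc v A A⁻¹ j ⟩
    (v · (A ⊗ A⁻¹)) j              ≈⟨ ·-congʳ v (proj₁ A-inverse) j ⟩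
    (v · idK) j                    ≈⟨ ·-identityʳ v j ⟩
    v j                            ∎)
    where
    H⊗lead≈A⁻¹ : (H ⊗ lead) ≈ₘ A⁻¹
    H⊗lead≈A⁻¹ a b = begin
      ((A⁻¹ a · L) · lead) b       ≈⟨ ·-assoc (A⁻¹ a) L lead b ⟩
      (A⁻¹ a · (L ⊗ lead)) b       ≈⟨ ·-congʳ (A⁻¹ a) (proj₁ (proj₂ invertible)) b ⟩
      (A⁻¹ a · idK) b              ≈⟨ ·-identityʳ (A⁻¹ a) b ⟩
      A⁻¹ a b                      ∎

  determined-by : ∀ n (v v' : Row d) → (∀ l → t l ℕ.≤ n → v l ≈ v' l) →
                  (∀ j → n ℕ.< t j → (v · A) j ≈ (v' · A) j) → v ≈ᵣ v'
  determined-by n v v' low high l = begin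
    v l                       ≈⟨ reconstruct v l ⟩
    (coords v · lead) l            ≈⟨ ·-congˡ lead (·-cancel (coords v) (coords v') agree) l ⟩
    (coords v' · lead) l           ≈⟨ sym (reconstruct v' l) ⟩
    v' l                      ∎
    where
    coords : Row d → Row d
    coords w = (w · A) · H
    agree : ∀ l → (coords v · lead) l ≈ (coords v' · lead) l ⊎ coords v l ≈ coords v' l
    agree l with t l ℕ.≤? n
    ... | yes tl≤n = inj₁ (trans (sym (reconstruct v l)) (trans (low l tl≤n) (reconstruct v' l)))
    ... | no tl≰n  = inj₂ (sum-cong-≋ {d} termwise)
      where
      termwise : ∀ j → (v · A) j * H j l ≈ (v' · A) j * H j l
      termwise j with n ℕ.<? t j
      ... | yes n<tj = *-congʳ (high j n<tj)
      ... | no n≮tj  = trans (*-congˡ Hⱼₗ≈0) (trans (zeroʳ _) (sym (trans (*-congˡ Hⱼₗ≈0) (zeroʳ _))))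
        where
        Hⱼₗ≈0 : H j l ≈ 0#
        Hⱼₗ≈0 = H-tlower j l (ℕ.≤-<-trans (ℕ.≮⇒≥ n≮tj) (ℕ.≰⇒> tl≰n))

  X₀ : Mat d
  X₀ = uRows lead

  X₁ : Mat d
  X₁ i j m = X i j (t j ℕ.+ m)

  high : Fin d → ℕ → Row d
  high r n k = (X₁ r k *s mono (t k) 1#) n

  high-≥ : ∀ r n k → t k ℕ.≤ n → high r n k ≈ X r k n
  high-≥ r n k tk≤n = trans (*s-mono-≥ (X₁ r k) (t k) 1# n tk≤n)
                            (trans (*-identityʳ _) (reflexive (≡.cong (X r k) (ℕ.m+[n∸m]≡n tk≤n))))

  high-< : ∀ r n k → n ℕ.< t k → high r n k ≈ 0#
  high-< r n k = *s-mono-< (X₁ r k) (t k) 1# n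

  X₁X₀-row : ∀ r n → (λ l → (X₁ *M X₀) r l n) ≈ᵣ (high r n · lead)
  X₁X₀-row r n l = trans (*M-coeff X₁ X₀ r l n) (sum-cong-≋ {d} (λ k → *s-mono-scale (X₁ r k) (t k) (lead k l) n))

  high-agrees : ∀ r n l → t l ℕ.≤ n → X r l n ≈ (high r n · lead) l
  high-agrees r n l tl≤n = sym (begin
    (high r n · lead) l    ≈⟨ ∑-single _ l off ⟩
    high r n l * lead l l  ≈⟨ *-cong (high-≥ r n l tl≤n) (lead-diag l) ⟩
    X r l n * 1#           ≈⟨ *-identityʳ _ ⟩
    X r l n                ∎)
    where
    off : ∀ k → k ≢ l → high r n k * lead k l ≈ 0#
    off k k≢l with t k ℕ.≤? n | ℕ.<-cmp (t k) (t l)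
    ... | no tk≰n | _ = trans (*-congʳ (high-< r n k (ℕ.≰⇒> tk≰n))) (zeroˡ _)
    ... | yes tk≤n | tri< tk<tl _ _ = trans (*-congʳ (trans (high-≥ r n k tk≤n)
                                        (X-vanishes-beyond r k n (ℕ.<-≤-trans (s<t tk<tl) tl≤n)))) (zeroˡ _)
    ... | yes _ | tri≈ _ tk≡tl _ = ⊥-elim (t-injective k l k≢l tk≡tl)
    ... | yes _ | tri> _ _ tl<tk = trans (*-congˡ (lead-tupper k l tl<tk)) (zeroʳ _)

  high-·-G : ∀ r n j → n ℕ.< t j → (high r n · G) j ≈ 0#
  high-·-G r n j n<tj = ∑-zero _ vanish
    where
    vanish : ∀ k → high r n k * G k j ≈ 0#
    vanish k with t k ℕ.≤? n
    ... | yes tk≤n = trans (*-congˡ (G-tlower k j (ℕ.≤-<-trans tk≤n n<tj))) (zeroʳ _)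
    ... | no tk≰n  = trans (*-congʳ (high-< r n k (ℕ.≰⇒> tk≰n))) (zeroˡ _)

  factorisation : X ≋M (X₁ *M X₀)
  factorisation i j n = trans (determined-by n (row i n) (high i n · lead) (high-agrees i n) high-A j)
                              (sym (X₁X₀-row i n j))
    where
    high-A : ∀ j → n ℕ.< t j → (row i n · A) j ≈ ((high i n · lead) · A) j
    high-A j n<tj = trans (row-·-A i n j n<tj)
                          (sym (trans (·-assoc (high i n) lead A j) (high-·-G i n j n<tj)))

  X₀-poly : PolyMat X₀
  X₀-poly i j = suc (t i) , λ n ti<n → mono-off (t i) n λ { ≡.refl → ℕ.<-irrefl ≡.refl ti<n }

  X₀-upper : UpperTriangular X₀
  X₀-upper i j j<i n = mono-≈0 (t i) n (lead-lower i j j<i)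

  X₀-diag : DiagIs X₀ t
  X₀-diag i n = trans (mono-cong (t i) n (lead-diag i)) (sym (uPow≋mono (t i) n))

  X₀-P : PropP X₀ t
  X₀-P i j _ = const (lead i j) , X₀≋ , (λ tj<ti n → trans (const≋mono (lead i j) n) (mono-≈0 0 n (lead-tupper i j tj<ti)))
             , (λ _ → lead i j , λ n → refl)
    where
    X₀≋ : X₀ i j ≋ (uPow (t i) *s const (lead i j))
    X₀≋ n = sym (begin
      (uPow (t i) *s const (lead i j)) n          ≈⟨ *s-cong (uPow≋mono (t i)) (const≋mono (lead i j)) n ⟩
      (mono (t i) 1# *s mono 0 (lead i j)) n      ≈⟨ mono-*s-mono (t i) 0 1# (lead i j) n ⟩
      mono (t i ℕ.+ 0) (1# * lead i j) n          ≈⟨ mono-exponent n (inj₁ (ℕ.+-identityʳ (t i))) ⟩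
      mono (t i) (1# * lead i j) n                ≈⟨ mono-cong (t i) n (*-identityˡ _) ⟩
      X₀ i j n                                    ∎)

  X₁-poly : PolyMat X₁
  X₁-poly i j with X-poly i j
  ... | N , vanish = N , λ m N≤m → vanish (t j ℕ.+ m) (ℕ.≤-trans N≤m (ℕ.m≤n+m m (t j)))

  X₁-upper : UpperTriangular X₁
  X₁-upper i j j<i m = X-upper i j j<i (t j ℕ.+ m)

  X₁-diag : DiagIs X₁ δs
  X₁-diag i m = trans (X-diag i (t i ℕ.+ m)) (reflexive (uPow-+ (t i) (δs i) m))

  X₁-deg : DEG X₁ δs
  X₁-deg i j i<j m δj≤m = X-deg i j i<j (t j ℕ.+ m) (ℕ.+-monoʳ-≤ (t j) δj≤m)

  B : Mat d
  B = uConj G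

  -- By separation, the exponent t i ∸ t j is either 0 or larger than δ.
  uConj-InRδ : ∀ M i j → InRδ δ (uConj M i j)
  uConj-InRδ M i j n 1≤n n<δ = mono-off (t i ℕ.∸ t j) n exponent-gap
    where
    exponent-gap : n ≢ t i ℕ.∸ t j
    exponent-gap n≡ti∸tj with t i ℕ.≤? t j
    ... | yes ti≤tj = ℕ.<⇒≱ 1≤n (ℕ.≤-reflexive (≡.trans n≡ti∸tj (ℕ.m≤n⇒m∸n≡0 ti≤tj)))
    ... | no ti≰tj  = ℕ.<-asym n<δ (≡.subst (δ ℕ.<_) (≡.sym n≡ti∸tj) δ<ti∸tj)
      where
      tj<ti : t j ℕ.< t i
      tj<ti = ℕ.≰⇒> ti≰tj
      δ<ti∸tj : δ ℕ.< t i ℕ.∸ t j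
      δ<ti∸tj = ℕ.+-cancelˡ-< (t j) δ (t i ℕ.∸ t j) (≡.subst (t j ℕ.+ δ ℕ.<_) (≡.sym (ℕ.m+[n∸m]≡n (ℕ.<⇒≤ tj<ti)))
                  (separation (λ { ≡.refl → ℕ.<-irrefl ≡.refl tj<ti }) (ℕ.<⇒≤ tj<ti)))

  B-GLδ : GLδ δ B
  B-GLδ = uConj-InRδ G , uConj H , uConj-InRδ H
        , uConj-inverse G-tlower H-tlower (proj₁ G-inverse)
        , uConj-inverse H-tlower G-tlower (proj₂ G-inverse)

  X₀A≋BD : (X₀ *M constM A) ≋M (B *M diagPow t)
  X₀A≋BD i j n = trans (uRows-*M-constM lead A i j n) (sym (uConj-*M-diagPow G-tlower i j n))

-- Imported only here: ℕ's _+_ would clash with the ring addition in the modules above.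
open import Data.Nat using (_+_; _<_; ∣_-_∣)

lemma3p2p1 : {c ℓ : Level} (F : Field c ℓ) (d : ℕ)
    (t δs : Fin d → ℕ) →
    (∀ i₁ i₂ → ¬ (i₁ ≡ i₂) → ¬ (t i₁ ≡ t i₂)) →
    (∀ i₁ i₂ → ¬ (i₁ ≡ i₂) → maxFin d δs < ∣ t i₁ - t i₂ ∣) →
    let open FieldDefs F in
    (X : Mat d) (A : MatK d) →
    PolyMat X → UpperTriangular X → DiagIs X (λ i → t i + δs i) →
    GLK A →
    DEG X (λ i → t i + δs i) →
    (∀ j i → UPowDivides (t i) ((X *M constM A) j i)) →
    Σ (Mat d) (λ X₁ → Σ (Mat d) (λ X₀ →
      (X ≋M (X₁ *M X₀))
      × (PolyMat X₀ × UpperTriangular X₀ × DiagIs X₀ t × PropP X₀ t)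
      × (PolyMat X₁ × UpperTriangular X₁ × DiagIs X₁ δs × DEG X₁ δs)
      × Σ (Mat d) (λ B → GLδ (maxFin d δs) B
                         × ((X₀ *M constM A) ≋M (B *M diagPow t)))))
lemma3p2p1 F d t δs t-injective separated X A X-poly X-upper X-diag A-invertible X-deg XA-divisible =
  X₁ , X₀ , factorisation
  , (X₀-poly , X₀-upper , X₀-diag , X₀-P)
  , (X₁-poly , X₁-upper , X₁-diag , X₁-deg)
  , B , B-GLδ , X₀A≋BD
  where
  open Factorisation F d t δs t-injective separated X A X-poly X-upper X-diag A-invertible X-deg XA-divisible
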